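{- Let $\alpha=(\alpha_1,\dots,\alpha_k)$ be a composition of $n$ and $\beta=(\beta_1,\dots,\beta_m)$ a weak composition of $n$. Then \[ I_{\beta,\alpha}(q)=\sum_S q^{\sum_{i=\min(S)+1}^m(\beta_i-\chi(S)_i)}\,I_{\beta-\chi(S),(\alpha_1,\dots,\alpha_{k-1})}(q), \] where the sum is over all subsets $S\subseteq[m]$ with $|S|=\alpha_k$ and $\beta_i>0$ for all $i\in S$.
   Context: An ordered multiset partition of weight $\beta$ is a sequence $\mu=(B_1|\dots|B_k)$ of nonempty sets of positive integers (no repeated letters within a block) whose multiset union is $\{1^{\beta_1},\dots,m^{\beta_m}\}$; its shape is $(|B_1|,\dots,|B_k|)$. An inversion of $\mu$ is a pair $i<j$ with $i=\min(B_s)$ and $j\in B_\ell$ for some $\ell<s$ (each occurrence counted); $\mathrm{inv}(\mu)$ is their number. $I_{\beta,\alpha}(q)=\sum_\mu q^{\mathrm{inv}(\mu)}$ over ordered multiset partitions $\mu$ of weight $\beta$ and shape $\alpha$ (with the empty partition of weight $0$ and empty shape contributing $1$). For $S\subseteq[m]$, $\chi(S)\in\{0,1\}^m$ is its indicator vector. -}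

module Defs where

open import Data.Nat using (ℕ; zero; suc; _+_; _*_; _∸_; _^_; _<_; _<?_)
open import Data.Bool using (Bool; true; false; if_then_else_)
open import Data.Fin using (Fin; toℕ)
import Data.Fin as Fin
open import Data.Fin.Subset using (Subset; inside; outside; ∣_∣)
open import Data.List as List using (List; []; _∷_; _++_; [_]; filter; map; concatMap)
open import Data.Vec as Vec using (Vec; []; _∷_; zipWith; replicate; tabulate; lookup)
import Data.Vec.Properties as VecP
open import Data.Maybe using (Maybe; just; nothing)
open import Data.Product using (_×_; _,_)
open import Relation.Nullary using (Dec; yes; no)
open import Relation.Nullary.Decidable using (_×-dec_)
open import Relation.Binary.PropositionalEquality using (_≡_)
import Data.Nat.Properties as ℕP
open import Data.Nat.ListAction using () renaming (sum to ℕsum)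
import Data.Vec.Relation.Unary.All as VAll

-- All subsets of [m] (letters 1..m are represented by Fin m, i ↦ i+1;
-- the order is preserved).
subsets : (m : ℕ) → List (Subset m)
subsets zero    = [ [] ]
subsets (suc m) = map (outside ∷_) (subsets m) ++ map (inside ∷_) (subsets m)

subsetsOfSize : (m k : ℕ) → List (Subset m)
subsetsOfSize m k = filter (λ S → ∣ S ∣ Data.Nat.≟ k) (subsets m)

χ : {m : ℕ} → Subset m → Vec ℕ m
χ S = Vec.map (λ b → if b then 1 else 0) S

minSub : {m : ℕ} → Subset m → Maybe (Fin m)
minSub []              = nothing
minSub (inside  ∷ S)   = just Fin.zero
minSub (outside ∷ S) with minSub S
... | just i  = just (Fin.suc i)
... | nothing = nothing

Σ[_] : (m : ℕ) → (Fin m → ℕ) → ℕ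
Σ[ zero  ] f = 0
Σ[ suc m ] f = f Fin.zero + Σ[ m ] (λ i → f (Fin.suc i))

-- An ordered multiset partition: a sequence of blocks (subsets of [m]).
OMP : ℕ → Set
OMP m = List (Subset m)

ofShape : (m : ℕ) → List ℕ → List (OMP m)
ofShape m []      = [ [] ]
ofShape m (a ∷ α) = concatMap (λ B → map (B ∷_) (ofShape m α)) (subsetsOfSize m a)

weight : {m : ℕ} → OMP m → Vec ℕ m
weight []      = replicate _ 0
weight (B ∷ μ) = zipWith _+_ (χ B) (weight μ)

OMPs : {m : ℕ} → Vec ℕ m → List ℕ → List (OMP m)
OMPs {m} β α = filter (λ μ → VecP.≡-dec Data.Nat._≟_ (weight μ) β) (ofShape m α)

above : {m : ℕ} → Subset m → Fin m → ℕ
above {m} C i = Σ[ m ] (λ j → if lookup C j then (if Relation.Nullary.Decidable.⌊ toℕ i <? toℕ j ⌋ then 1 else 0) else 0)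
  where import Relation.Nullary.Decidable

invAgainst : {m : ℕ} → List (Subset m) → Subset m → ℕ
invAgainst prev B with minSub B
... | nothing = 0
... | just i  = ℕsum (map (λ C → above C i) prev)

-- inv(μ): pairs i<j with i = min B_s, j ∈ B_ℓ, ℓ < s (each occurrence counted).
invGo : {m : ℕ} → List (Subset m) → OMP m → ℕ
invGo prev []      = 0
invGo prev (B ∷ μ) = invAgainst prev B + invGo (prev ++ [ B ]) μ

inv : {m : ℕ} → OMP m → ℕ
inv μ = invGo [] μ

I : {m : ℕ} → Vec ℕ m → List ℕ → ℕ → ℕ
I β α q = ℕsum (map (λ μ → q ^ inv μ) (OMPs β α))

admissible : {m : ℕ} → Vec ℕ m → ℕ → List (Subset m)
admissible {m} β a =
  filter (λ S → VAll.all? (λ i → (lookup S i Data.Bool.≟ false) Relation.Nullary.Decidable.⊎-dec (0 <? lookup β i)) (Vec.allFin m))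
         (subsetsOfSize m a)
  where import Relation.Nullary.Decidable; import Data.Bool

shiftExp : {m : ℕ} → Vec ℕ m → Subset m → ℕ
shiftExp {m} β S with minSub S
... | nothing = 0
... | just k  = Σ[ m ] (λ i → if Relation.Nullary.Decidable.⌊ toℕ k <? toℕ i ⌋
                               then lookup β i ∸ lookup (χ S) i else 0)
  where import Relation.Nullary.Decidable

_−χ_ : {m : ℕ} → Vec ℕ m → Subset m → Vec ℕ m
β −χ S = zipWith _∸_ β (χ S)

RHS : {m : ℕ} → Vec ℕ m → List ℕ → ℕ → ℕ → ℕ
RHS β α′ a q = ℕsum (map (λ S → q ^ shiftExp β S * I (β −χ S) α′ q) (admissible β a))

-- An ordered multiset partition of shape (α′, a) is a partition ν of shape α′
-- followed by a last block S with |S| = a. It has weight β exactly when every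
-- letter of S occurs in β and ν has weight β − χ(S). The inversions of (ν | S)
-- are those of ν together with the pairs (min S, j) with j in a block of ν and
-- j > min S; there are Σ_{j > min S} (β − χ(S))_j of these, independently of ν.
-- Summing q^inv first over ν and then over S gives the recursion.
module Submission where

open import Defs
open import Data.Bool using (Bool; true; false; if_then_else_)
open import Data.Empty using (⊥-elim)
open import Data.Fin using (Fin; toℕ)
import Data.Fin as Fin
open import Data.Fin.Subset using (Subset)
open import Data.List using (List; []; _∷_; _++_; [_]; _∷ʳ_; filter; map; concatMap)
open import Data.List.Properties using (map-cong; map-∘; map-++; ++-assoc; ++-identityʳ)
open import Data.List.Relation.Unary.All using (All)
open import Data.Maybe using (just; nothing)
open import Data.Nat using (ℕ; zero; suc; _+_; _*_; _∸_; _^_; _<_; _≟_; _<?_; z<s; s≤s)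
open import Data.Nat.ListAction using (sum)
open import Data.Nat.ListAction.Properties using (sum-++)
open import Data.Nat.Properties
open import Algebra.Properties.CommutativeSemigroup +-commutativeSemigroup using (interchange)
open import Data.Product using (_×_; _,_; proj₁; proj₂)
open import Data.Sum using (_⊎_; inj₁; inj₂)
open import Data.Vec using (Vec; toList; lookup; allFin; replicate; tabulate; zipWith)
import Data.Vec.Properties as VecP
import Data.Vec.Relation.Unary.All as VAll
open import Data.Vec.Relation.Unary.All.Properties using (tabulate⁺; tabulate⁻)
open import Function using (_∘_; _⇔_; mk⇔; Equivalence)
open import Relation.Binary.PropositionalEquality
  using (_≡_; refl; sym; trans; cong; cong₂; subst; module ≡-Reasoning)
open import Relation.Nullary using (Dec; yes; no; does; ¬_)
open import Relation.Nullary.Decidable using (⌊_⌋)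
import Data.Bool.Properties as BoolP
import Relation.Nullary.Decidable as Dec

open ≡-Reasoning

∑ : {A : Set} → List A → (A → ℕ) → ℕ
∑ xs f = sum (map f xs)

syntax ∑ xs (λ x → e) = ∑[ x ∈ xs ] e

bit : Bool → ℕ
bit b = if b then 1 else 0

when : {P : Set} → Dec P → ℕ → ℕ
when P? x = if does P? then x else 0

module _ {A : Set} where

  ∑-cong : ∀ {f g : A → ℕ} xs → (∀ x → f x ≡ g x) → ∑ xs f ≡ ∑ xs g
  ∑-cong xs f≗g = cong sum (map-cong f≗g xs)

  ∑-zero : ∀ (xs : List A) → ∑[ x ∈ xs ] 0 ≡ 0
  ∑-zero []       = refl
  ∑-zero (x ∷ xs) = ∑-zero xs

  ∑-+ : ∀ (f g : A → ℕ) xs → ∑[ x ∈ xs ] (f x + g x) ≡ ∑ xs f + ∑ xs g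
  ∑-+ f g []       = refl
  ∑-+ f g (x ∷ xs) = trans (cong (f x + g x +_) (∑-+ f g xs)) (interchange (f x) (g x) _ _)

  ∑-*ˡ : ∀ c (f : A → ℕ) xs → ∑[ x ∈ xs ] (c * f x) ≡ c * ∑ xs f
  ∑-*ˡ c f []       = sym (*-zeroʳ c)
  ∑-*ˡ c f (x ∷ xs) = trans (cong (c * f x +_) (∑-*ˡ c f xs)) (sym (*-distribˡ-+ c (f x) _))

  ∑-filter : ∀ {P : A → Set} (P? : ∀ x → Dec (P x)) (f : A → ℕ) xs →
             ∑ (filter P? xs) f ≡ ∑[ x ∈ xs ] when (P? x) (f x)
  ∑-filter P? f []       = refl
  ∑-filter P? f (x ∷ xs) with does (P? x)
  ... | true  = cong (f x +_) (∑-filter P? f xs)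
  ... | false = ∑-filter P? f xs

  ∑-map : ∀ {B : Set} (f : B → ℕ) (h : A → B) xs → ∑ (map h xs) f ≡ ∑ xs (f ∘ h)
  ∑-map f h xs = cong sum (sym (map-∘ xs))

  ∑-concatMap : ∀ {B : Set} (f : B → ℕ) (g : A → List B) xs →
                ∑ (concatMap g xs) f ≡ ∑[ x ∈ xs ] ∑ (g x) f
  ∑-concatMap f g []       = refl
  ∑-concatMap f g (x ∷ xs) = begin
    sum (map f (g x ++ concatMap g xs))          ≡⟨ cong sum (map-++ f (g x) _) ⟩
    sum (map f (g x) ++ map f (concatMap g xs))  ≡⟨ sum-++ (map f (g x)) _ ⟩
    ∑ (g x) f + ∑ (concatMap g xs) f             ≡⟨ cong (∑ (g x) f +_) (∑-concatMap f g xs) ⟩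
    ∑ (g x) f + ∑[ y ∈ xs ] ∑ (g y) f            ∎

∑-comm : ∀ {A B : Set} (F : A → B → ℕ) xs ys →
         ∑[ x ∈ xs ] ∑[ y ∈ ys ] F x y ≡ ∑[ y ∈ ys ] ∑[ x ∈ xs ] F x y
∑-comm F []       ys = sym (∑-zero ys)
∑-comm F (x ∷ xs) ys =
  trans (cong (∑ ys (F x) +_) (∑-comm F xs ys)) (sym (∑-+ (F x) _ ys))

Σ-cong : ∀ m {f g : Fin m → ℕ} → (∀ i → f i ≡ g i) → Σ[ m ] f ≡ Σ[ m ] g
Σ-cong zero    f≗g = refl
Σ-cong (suc m) f≗g = cong₂ _+_ (f≗g Fin.zero) (Σ-cong m (f≗g ∘ Fin.suc))

Σ-zero : ∀ m → Σ[ m ] (λ _ → 0) ≡ 0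
Σ-zero zero    = refl
Σ-zero (suc m) = Σ-zero m

Σ-+ : ∀ m (f g : Fin m → ℕ) → Σ[ m ] (λ i → f i + g i) ≡ Σ[ m ] f + Σ[ m ] g
Σ-+ zero    f g = refl
Σ-+ (suc m) f g =
  trans (cong (f Fin.zero + g Fin.zero +_) (Σ-+ m (f ∘ Fin.suc) (g ∘ Fin.suc)))
        (interchange (f Fin.zero) (g Fin.zero) _ _)

bit-* : ∀ b x → bit b * x ≡ (if b then x else 0)
bit-* true  x = +-identityʳ x
bit-* false x = refl

*-bit : ∀ b x → x * bit b ≡ (if b then x else 0)
*-bit true  x = *-identityʳ x
*-bit false x = *-zeroʳ x

+-bit≡⇔ : ∀ b w c → (w + bit b ≡ c) ⇔ ((b ≡ false ⊎ 0 < c) × w ≡ c ∸ bit b)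
+-bit≡⇔ true  w c = mk⇔ to from
  where
  to : w + 1 ≡ c → (true ≡ false ⊎ 0 < c) × w ≡ c ∸ 1
  to refl = inj₂ (subst (0 <_) (+-comm 1 w) z<s) , sym (m+n∸n≡m w 1)
  from : (true ≡ false ⊎ 0 < c) × w ≡ c ∸ 1 → w + 1 ≡ c
  from (inj₂ (s≤s _) , refl) = +-comm _ 1
+-bit≡⇔ false w c = mk⇔ (λ w≡c → inj₁ refl , trans (sym (+-identityʳ w)) w≡c)
                        (λ (_ , w≡c) → trans (+-identityʳ w) w≡c)

∑-ofShape-∷ʳ : ∀ {m} (F : OMP m → ℕ) α′ a →
  ∑ (ofShape m (α′ ∷ʳ a)) F ≡ ∑[ ν ∈ ofShape m α′ ] ∑[ S ∈ subsetsOfSize m a ] F (ν ∷ʳ S)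
∑-ofShape-∷ʳ {m} F [] a = begin
  ∑ (concatMap (λ B → [ B ∷ [] ]) (subsetsOfSize m a)) F
    ≡⟨ ∑-concatMap F (λ B → [ B ∷ [] ]) (subsetsOfSize m a) ⟩
  ∑[ S ∈ subsetsOfSize m a ] (F (S ∷ []) + 0)
    ≡⟨ ∑-cong (subsetsOfSize m a) (λ S → +-identityʳ _) ⟩
  ∑[ S ∈ subsetsOfSize m a ] F (S ∷ [])
    ≡⟨ +-identityʳ _ ⟨
  ∑[ S ∈ subsetsOfSize m a ] F (S ∷ []) + 0
    ∎
∑-ofShape-∷ʳ {m} F (b ∷ α′) a = begin
  ∑ (concatMap (λ B → map (B ∷_) (ofShape m (α′ ∷ʳ a))) (subsetsOfSize m b)) F
    ≡⟨ ∑-concatMap F _ (subsetsOfSize m b) ⟩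
  ∑[ B ∈ subsetsOfSize m b ] ∑ (map (B ∷_) (ofShape m (α′ ∷ʳ a))) F
    ≡⟨ ∑-cong (subsetsOfSize m b) (λ B → ∑-map F (B ∷_) (ofShape m (α′ ∷ʳ a))) ⟩
  ∑[ B ∈ subsetsOfSize m b ] ∑[ ν ∈ ofShape m (α′ ∷ʳ a) ] F (B ∷ ν)
    ≡⟨ ∑-cong (subsetsOfSize m b) (λ B → ∑-ofShape-∷ʳ (F ∘ (B ∷_)) α′ a) ⟩
  ∑[ B ∈ subsetsOfSize m b ] ∑[ ν ∈ ofShape m α′ ] G (B ∷ ν)
    ≡⟨ ∑-cong (subsetsOfSize m b) (λ B → ∑-map G (B ∷_) (ofShape m α′)) ⟨
  ∑[ B ∈ subsetsOfSize m b ] ∑ (map (B ∷_) (ofShape m α′)) G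
    ≡⟨ ∑-concatMap G _ (subsetsOfSize m b) ⟨
  ∑ (concatMap (λ B → map (B ∷_) (ofShape m α′)) (subsetsOfSize m b)) G
    ∎
  where
  G : OMP m → ℕ
  G ν = ∑[ S ∈ subsetsOfSize m a ] F (ν ∷ʳ S)

invGo-∷ʳ : ∀ {m} (prev μ : List (Subset m)) S →
           invGo prev (μ ∷ʳ S) ≡ invGo prev μ + invAgainst (prev ++ μ) S
invGo-∷ʳ prev []      S = trans (+-identityʳ _) (cong (λ p → invAgainst p S) (sym (++-identityʳ prev)))
invGo-∷ʳ prev (B ∷ μ) S = begin
  invAgainst prev B + invGo (prev ∷ʳ B) (μ ∷ʳ S)
    ≡⟨ cong (invAgainst prev B +_) (invGo-∷ʳ (prev ∷ʳ B) μ S) ⟩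
  invAgainst prev B + (invGo (prev ∷ʳ B) μ + invAgainst ((prev ∷ʳ B) ++ μ) S)
    ≡⟨ cong (λ p → invAgainst prev B + (invGo (prev ∷ʳ B) μ + invAgainst p S)) (++-assoc prev [ B ] μ) ⟩
  invAgainst prev B + (invGo (prev ∷ʳ B) μ + invAgainst (prev ++ B ∷ μ) S)
    ≡⟨ +-assoc (invAgainst prev B) _ _ ⟨
  invAgainst prev B + invGo (prev ∷ʳ B) μ + invAgainst (prev ++ B ∷ μ) S
    ∎

inv-∷ʳ : ∀ {m} (μ : OMP m) S → inv (μ ∷ʳ S) ≡ inv μ + invAgainst μ S
inv-∷ʳ μ S = invGo-∷ʳ [] μ S

lookup-ext : ∀ {n} (u v : Vec ℕ n) → (∀ i → lookup u i ≡ lookup v i) → u ≡ v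
lookup-ext u v u≗v = begin
  u                   ≡⟨ sym (VecP.tabulate∘lookup u) ⟩
  tabulate (lookup u) ≡⟨ VecP.tabulate-cong u≗v ⟩
  tabulate (lookup v) ≡⟨ VecP.tabulate∘lookup v ⟩
  v                   ∎

lookup-χ : ∀ {m} (S : Subset m) i → lookup (χ S) i ≡ bit (lookup S i)
lookup-χ S i = VecP.lookup-map i bit S

lookup-−χ : ∀ {m} (β : Vec ℕ m) S i → lookup (β −χ S) i ≡ lookup β i ∸ bit (lookup S i)
lookup-−χ β S i = trans (VecP.lookup-zipWith _∸_ i β (χ S)) (cong (lookup β i ∸_) (lookup-χ S i))

lookup-weight-∷ʳ : ∀ {m} (μ : OMP m) S i →
                   lookup (weight (μ ∷ʳ S)) i ≡ lookup (weight μ) i + bit (lookup S i)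
lookup-weight-∷ʳ {m} [] S i = begin
  lookup (zipWith _+_ (χ S) (replicate m 0)) i
    ≡⟨ VecP.lookup-zipWith _+_ i (χ S) (replicate m 0) ⟩
  lookup (χ S) i + lookup (replicate m 0) i
    ≡⟨ cong₂ _+_ (lookup-χ S i) (VecP.lookup-replicate i 0) ⟩
  bit (lookup S i) + 0
    ≡⟨ +-comm _ 0 ⟩
  0 + bit (lookup S i)
    ≡⟨ cong (_+ bit (lookup S i)) (VecP.lookup-replicate i 0) ⟨
  lookup (replicate m 0) i + bit (lookup S i)
    ∎
lookup-weight-∷ʳ (B ∷ μ) S i = begin
  lookup (zipWith _+_ (χ B) (weight (μ ∷ʳ S))) i
    ≡⟨ VecP.lookup-zipWith _+_ i (χ B) (weight (μ ∷ʳ S)) ⟩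
  lookup (χ B) i + lookup (weight (μ ∷ʳ S)) i
    ≡⟨ cong (lookup (χ B) i +_) (lookup-weight-∷ʳ μ S i) ⟩
  lookup (χ B) i + (lookup (weight μ) i + bit (lookup S i))
    ≡⟨ +-assoc (lookup (χ B) i) _ _ ⟨
  lookup (χ B) i + lookup (weight μ) i + bit (lookup S i)
    ≡⟨ cong (_+ bit (lookup S i)) (VecP.lookup-zipWith _+_ i (χ B) (weight μ)) ⟨
  lookup (zipWith _+_ (χ B) (weight μ)) i + bit (lookup S i)
    ∎

Admissible : ∀ {m} → Vec ℕ m → Subset m → Set
Admissible β S = ∀ i → lookup S i ≡ false ⊎ 0 < lookup β i

infix 4 _≟ᵥ_
_≟ᵥ_ : ∀ {m} (u v : Vec ℕ m) → Dec (u ≡ v)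
_≟ᵥ_ = VecP.≡-dec _≟_

admissible? : ∀ {m} (β : Vec ℕ m) S → Dec (VAll.All (λ i → lookup S i ≡ false ⊎ 0 < lookup β i) (allFin m))
admissible? {m} β S = VAll.all? (λ i → (lookup S i BoolP.≟ false) Dec.⊎-dec (0 <? lookup β i)) (allFin m)

weight-∷ʳ≡⇔ : ∀ {m} (β : Vec ℕ m) μ S → weight (μ ∷ʳ S) ≡ β ⇔ (Admissible β S × weight μ ≡ β −χ S)
weight-∷ʳ≡⇔ β μ S = mk⇔ to from
  where
  coordinate : ∀ i → (lookup (weight μ) i + bit (lookup S i) ≡ lookup β i) ⇔ _
  coordinate i = +-bit≡⇔ (lookup S i) (lookup (weight μ) i) (lookup β i)

  to : weight (μ ∷ʳ S) ≡ β → Admissible β S × weight μ ≡ β −χ S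
  to w≡β = (λ i → proj₁ (split i))
         , lookup-ext _ _ (λ i → trans (proj₂ (split i)) (sym (lookup-−χ β S i)))
    where
    split : ∀ i → (lookup S i ≡ false ⊎ 0 < lookup β i)
                × lookup (weight μ) i ≡ lookup β i ∸ bit (lookup S i)
    split i = Equivalence.to (coordinate i)
                (trans (sym (lookup-weight-∷ʳ μ S i)) (cong (λ v → lookup v i) w≡β))

  from : Admissible β S × weight μ ≡ β −χ S → weight (μ ∷ʳ S) ≡ β
  from (adm , w≡β−χ) = lookup-ext _ _ (λ i →
    trans (lookup-weight-∷ʳ μ S i)
          (Equivalence.from (coordinate i)
            (adm i , trans (cong (λ v → lookup v i) w≡β−χ) (lookup-−χ β S i))))

after : ∀ {m} → Fin m → Fin m → Bool
after k j = ⌊ toℕ k <? toℕ j ⌋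

∑-above : ∀ {m} (k : Fin m) (μ : OMP m) →
          ∑[ C ∈ μ ] above C k ≡ Σ[ m ] (λ j → lookup (weight μ) j * bit (after k j))
∑-above {m} k [] = sym (begin
  Σ[ m ] (λ j → lookup (replicate m 0) j * bit (after k j))
    ≡⟨ Σ-cong m (λ j → cong (_* bit (after k j)) (VecP.lookup-replicate j 0)) ⟩
  Σ[ m ] (λ _ → 0)
    ≡⟨ Σ-zero m ⟩
  0 ∎)
∑-above {m} k (C ∷ μ) = begin
  above C k + ∑[ D ∈ μ ] above D k
    ≡⟨ cong (above C k +_) (∑-above k μ) ⟩
  above C k + Σ[ m ] (λ j → lookup (weight μ) j * bit (after k j))
    ≡⟨ Σ-+ m _ _ ⟨
  Σ[ m ] (λ j → (if lookup C j then bit (after k j) else 0) + lookup (weight μ) j * bit (after k j))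
    ≡⟨ Σ-cong m (λ j → cong (_+ _) (trans (cong (_* _) (lookup-χ C j)) (bit-* (lookup C j) _))) ⟨
  Σ[ m ] (λ j → lookup (χ C) j * bit (after k j) + lookup (weight μ) j * bit (after k j))
    ≡⟨ Σ-cong m (λ j → *-distribʳ-+ (bit (after k j)) (lookup (χ C) j) _) ⟨
  Σ[ m ] (λ j → (lookup (χ C) j + lookup (weight μ) j) * bit (after k j))
    ≡⟨ Σ-cong m (λ j → cong (_* bit (after k j)) (VecP.lookup-zipWith _+_ j (χ C) (weight μ))) ⟨
  Σ[ m ] (λ j → lookup (weight (C ∷ μ)) j * bit (after k j))
    ∎

invAgainst≡shiftExp : ∀ {m} (β : Vec ℕ m) μ S → weight μ ≡ β −χ S → invAgainst μ S ≡ shiftExp β S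
invAgainst≡shiftExp {m} β μ S w≡β−χ with minSub S
... | nothing = refl
... | just k  = trans (∑-above k μ) (Σ-cong m (λ j → begin
  lookup (weight μ) j * bit (after k j)
    ≡⟨ cong (λ v → lookup v j * bit (after k j)) w≡β−χ ⟩
  lookup (β −χ S) j * bit (after k j)
    ≡⟨ cong (_* bit (after k j)) (VecP.lookup-zipWith _∸_ j β (χ S)) ⟩
  (lookup β j ∸ lookup (χ S) j) * bit (after k j)
    ≡⟨ *-bit (after k j) _ ⟩
  (if after k j then lookup β j ∸ lookup (χ S) j else 0)
    ∎))

module _ {m} (β : Vec ℕ m) (q : ℕ) where

  term : OMP m → ℕ
  term μ = when (weight μ ≟ᵥ β) (q ^ inv μ)

  term-∷ʳ-admissible : ∀ μ S → Admissible β S →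
                       term (μ ∷ʳ S) ≡ q ^ shiftExp β S * when (weight μ ≟ᵥ β −χ S) (q ^ inv μ)
  term-∷ʳ-admissible μ S adm with weight (μ ∷ʳ S) ≟ᵥ β | weight μ ≟ᵥ β −χ S
  ... | yes _     | yes w≡β−χ = begin
    q ^ inv (μ ∷ʳ S)                   ≡⟨ cong (q ^_) (inv-∷ʳ μ S) ⟩
    q ^ (inv μ + invAgainst μ S)       ≡⟨ cong (λ e → q ^ (inv μ + e)) (invAgainst≡shiftExp β μ S w≡β−χ) ⟩
    q ^ (inv μ + shiftExp β S)         ≡⟨ ^-distribˡ-+-* q (inv μ) _ ⟩
    q ^ inv μ * q ^ shiftExp β S       ≡⟨ *-comm (q ^ inv μ) _ ⟩
    q ^ shiftExp β S * q ^ inv μ       ∎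
  ... | yes w∷ʳS≡β | no w≢β−χ = ⊥-elim (w≢β−χ (proj₂ (Equivalence.to (weight-∷ʳ≡⇔ β μ S) w∷ʳS≡β)))
  ... | no w∷ʳS≢β  | yes w≡β−χ = ⊥-elim (w∷ʳS≢β (Equivalence.from (weight-∷ʳ≡⇔ β μ S) (adm , w≡β−χ)))
  ... | no _      | no _      = sym (*-zeroʳ (q ^ shiftExp β S))

  term-∷ʳ-inadmissible : ∀ μ S → ¬ Admissible β S → term (μ ∷ʳ S) ≡ 0
  term-∷ʳ-inadmissible μ S ¬adm with weight (μ ∷ʳ S) ≟ᵥ β
  ... | yes w∷ʳS≡β = ⊥-elim (¬adm (proj₁ (Equivalence.to (weight-∷ʳ≡⇔ β μ S) w∷ʳS≡β)))
  ... | no _      = refl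

  ∑-term-∷ʳ : ∀ α′ S → ∑[ ν ∈ ofShape m α′ ] term (ν ∷ʳ S)
                       ≡ when (admissible? β S) (q ^ shiftExp β S * I (β −χ S) α′ q)
  ∑-term-∷ʳ α′ S with admissible? β S
  ... | yes adm = begin
    ∑[ ν ∈ ofShape m α′ ] term (ν ∷ʳ S)
      ≡⟨ ∑-cong (ofShape m α′) (λ ν → term-∷ʳ-admissible ν S (tabulate⁻ adm)) ⟩
    ∑[ ν ∈ ofShape m α′ ] (q ^ shiftExp β S * when (weight ν ≟ᵥ β −χ S) (q ^ inv ν))
      ≡⟨ ∑-*ˡ (q ^ shiftExp β S) _ (ofShape m α′) ⟩
    q ^ shiftExp β S * ∑[ ν ∈ ofShape m α′ ] when (weight ν ≟ᵥ β −χ S) (q ^ inv ν)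
      ≡⟨ cong (q ^ shiftExp β S *_) (∑-filter (λ ν → weight ν ≟ᵥ β −χ S) ((q ^_) ∘ inv) (ofShape m α′)) ⟨
    q ^ shiftExp β S * I (β −χ S) α′ q
      ∎
  ... | no ¬adm = trans (∑-cong (ofShape m α′) (λ ν → term-∷ʳ-inadmissible ν S (¬adm ∘ tabulate⁺)))
                        (∑-zero (ofShape m α′))

lemma3p2 : (n m : ℕ) (α′ : List ℕ) (a : ℕ) (β : Vec ℕ m) →
    All (0 <_) (α′ ∷ʳ a) → sum (α′ ∷ʳ a) ≡ n →
    sum (toList β) ≡ n →
    (q : ℕ) → I β (α′ ∷ʳ a) q ≡ RHS β α′ a q
lemma3p2 n m α′ a β _ _ _ q = begin
  I β (α′ ∷ʳ a) q
    ≡⟨ ∑-filter (λ μ → weight μ ≟ᵥ β) (λ μ → q ^ inv μ) (ofShape m (α′ ∷ʳ a)) ⟩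
  ∑ (ofShape m (α′ ∷ʳ a)) (term β q)
    ≡⟨ ∑-ofShape-∷ʳ (term β q) α′ a ⟩
  ∑[ ν ∈ ofShape m α′ ] ∑[ S ∈ subsetsOfSize m a ] term β q (ν ∷ʳ S)
    ≡⟨ ∑-comm (λ ν S → term β q (ν ∷ʳ S)) (ofShape m α′) (subsetsOfSize m a) ⟩
  ∑[ S ∈ subsetsOfSize m a ] ∑[ ν ∈ ofShape m α′ ] term β q (ν ∷ʳ S)
    ≡⟨ ∑-cong (subsetsOfSize m a) (∑-term-∷ʳ β q α′) ⟩
  ∑[ S ∈ subsetsOfSize m a ] when (admissible? β S) (q ^ shiftExp β S * I (β −χ S) α′ q)
    ≡⟨ ∑-filter (admissible? β) (λ S → q ^ shiftExp β S * I (β −χ S) α′ q) (subsetsOfSize m a) ⟨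
  RHS β α′ a q
    ∎
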